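{- Let $\ell\ge 3$ be odd and let $D=\{d_1,d_2,\dots,d_{(\ell-3)/2}\}$ be a set of $(\ell-3)/2$ distinct elements of $\{1,2,\dots,\ell-1\}$ with $d_1>d_2>\cdots>d_{(\ell-3)/2}$. There exists an $\ell$-cycle $C$ on vertex set $\mathbb{Z}_{2\ell}\cup\{\infty\}$ with $\partial(C)=\pm D\cup\{\ell\}$.
   Context: Here $\infty$ is a point not in $\mathbb{Z}_{2\ell}$, and $\partial(C)$ denotes the set of differences $\{\pm(x-y) \bmod 2\ell : xy \text{ an edge of } C,\ x,y\in\mathbb{Z}_{2\ell}\}$ (edges through $\infty$ are ignored); $\pm D=\{d,-d : d\in D\}\subseteq \mathbb{Z}_{2\ell}$. -}

module Defs where

open import Data.Nat using (ℕ; zero; suc; _+_; _*_; _∸_; _<_; _>_; _≤_)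
open import Data.Nat.DivMod using (_%_; m%n<n)
open import Data.Fin using (Fin; toℕ; fromℕ<)
open import Data.Maybe using (Maybe; just; nothing)
open import Data.List using (List)
open import Data.List.Membership.Propositional using (_∈_)
open import Data.Product using (Σ; ∃; _×_; _,_)
open import Data.Sum using (_⊎_)
open import Relation.Binary.PropositionalEquality using (_≡_)
open import Function.Definitions using (Injective)

-- Vertex set Z_{2ℓ} ∪ {∞}: 'just x' is x ∈ Z_{2ℓ} (Fin (2ℓ)), 'nothing' is ∞.
Vertex : ℕ → Set
Vertex ℓ = Maybe (Fin (2 * ℓ))

next : ∀ {n} → Fin n → Fin n
next {suc n} i = fromℕ< (m%n<n (suc (toℕ i)) (suc n))

-- An ℓ-cycle on vertex set V: ℓ distinct vertices v 0, …, v (ℓ-1),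
-- with edges {v i, v (i+1 mod ℓ)}.
record Cycle (V : Set) (ℓ : ℕ) : Set where
  field
    vert     : Fin ℓ → V
    distinct : Injective _≡_ _≡_ vert
open Cycle public

-- (x - y) mod m, for x y < m
diffMod : ℕ → ℕ → ℕ → ℕ
diffMod zero x y = 0
diffMod (suc k) x y = ((x + suc k) ∸ y) % suc k

_∈∂_ : ∀ {ℓ} → ℕ → Cycle (Vertex ℓ) ℓ → Set
_∈∂_ {ℓ} d C =
  Σ (Fin ℓ) λ i → Σ (Fin (2 * ℓ)) λ x → Σ (Fin (2 * ℓ)) λ y →
    (vert C i ≡ just x) × (vert C (next i) ≡ just y) ×
    ((d ≡ diffMod (2 * ℓ) (toℕ x) (toℕ y)) ⊎ (d ≡ diffMod (2 * ℓ) (toℕ y) (toℕ x)))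

-- d ∈ ±D ∪ {ℓ}, as a residue in {0, …, 2ℓ-1}
InPmDℓ : ℕ → List ℕ → ℕ → Set
InPmDℓ ℓ D d = (d ≡ ℓ) ⊎ (Σ ℕ λ e → (e ∈ D) × ((d ≡ e) ⊎ (d ≡ (2 * ℓ) ∸ e)))

{-# OPTIONS --safe #-}
-- Write ℓ = 2k + 3 and D = d₁ > ⋯ > d_k. The alternating sums z₀ = 0, z₁ = d₁, z₂ = d₁ − d₂,
-- z₃ = d₁ − d₂ + d₃, … stay in [0, d₁] because D decreases, are pairwise distinct, and
-- consecutive ones differ by d₁, …, d_k. The cycle ∞, z₀, …, z_k, z_k + ℓ, …, z₀ + ℓ has
-- ℓ vertices; its edges avoiding ∞ have lengths d₁, …, d_k, then ℓ, then d_k, …, d₁ again,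
-- so ∂(C) = ±D ∪ {ℓ}.
module Submission where

open import Defs
open import Data.Nat using (ℕ; zero; suc; _+_; _*_; _∸_; _/_; _%_; _≤_; _<_; _>_; z≤n; s≤s; _≤?_; NonZero)
open import Data.Nat.Properties
open import Data.Nat.DivMod using (_mod_; m<n⇒m%n≡m; [m+n]%n≡m%n; n%n≡0; m/n≡1+[m∸n]/n)
open import Data.Fin using (Fin; toℕ; fromℕ<)
open import Data.Fin.Properties using (toℕ-fromℕ<; toℕ-injective; toℕ<n)
open import Data.Maybe using (just; nothing)
open import Data.Maybe.Properties using (just-injective)
open import Data.List using (List; []; _∷_; length)
open import Data.List.Membership.Propositional using (_∈_)
open import Data.List.Relation.Unary.All as All using (All; []; _∷_)
open import Data.List.Relation.Unary.Any using (here; there)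
open import Data.List.Relation.Unary.Linked as Linked using (Linked; [-]; _∷_)
open import Data.List.Relation.Unary.Linked.Properties using (Linked⇒All)
open import Data.Product using (Σ; ∃-syntax; _×_; _,_; proj₁; proj₂)
open import Data.Sum using (_⊎_; inj₁; inj₂; swap)
open import Data.Empty using (⊥-elim)
open import Function using (id; _∘_)
open import Function.Bundles using (_⇔_; mk⇔; module Equivalence)
open import Function.Construct.Composition using (_⇔-∘_)
open import Function.Construct.Symmetry using (⇔-sym)
open import Algebra.Properties.CommutativeSemigroup +-commutativeSemigroup using (xy∙z≈xz∙y)
open import Relation.Nullary using (yes; no)
open import Relation.Binary.Definitions using (tri<; tri≈; tri>)
open import Relation.Binary.PropositionalEquality
  using (_≡_; _≢_; refl; sym; trans; cong; cong₂; subst; subst₂; module ≡-Reasoning)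

open ≡-Reasoning

Differ : ℕ → ℕ → ℕ → Set
Differ e a b = b ≡ a + e ⊎ a ≡ b + e

Differ-+ʳ : ∀ {e a b} c → Differ e a b → Differ e (a + c) (b + c)
Differ-+ʳ {e} {a}     c (inj₁ refl) = inj₁ (xy∙z≈xz∙y a e c)
Differ-+ʳ {e} {b = b} c (inj₂ refl) = inj₂ (xy∙z≈xz∙y b e c)

m∸n≡m∸[n+o]+o : ∀ m n o → n + o ≤ m → m ∸ n ≡ m ∸ (n + o) + o
m∸n≡m∸[n+o]+o m n o n+o≤m = begin
  m ∸ n                     ≡⟨ cong (_∸ n) (m∸n+n≡m n+o≤m) ⟨
  m ∸ (n + o) + (n + o) ∸ n ≡⟨ cong (_∸ n) (+-assoc (m ∸ (n + o)) n o) ⟨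
  m ∸ (n + o) + n + o ∸ n   ≡⟨ cong (_∸ n) (xy∙z≈xz∙y (m ∸ (n + o)) n o) ⟩
  m ∸ (n + o) + o + n ∸ n   ≡⟨ m+n∸n≡m (m ∸ (n + o) + o) n ⟩
  m ∸ (n + o) + o           ∎

Differ-reflect : ∀ {e a b} c → a ≤ c → b ≤ c → Differ e a b → Differ e (c ∸ a) (c ∸ b)
Differ-reflect {e} {a}     c _   b≤c (inj₁ refl) = inj₂ (m∸n≡m∸[n+o]+o c a e b≤c)
Differ-reflect {e} {b = b} c a≤c _   (inj₂ refl) = inj₁ (m∸n≡m∸[n+o]+o c b e a≤c)

ModDiff : ℕ → ℕ → ℕ → ℕ → Set
ModDiff n a b d = d ≡ diffMod n a b ⊎ d ≡ diffMod n b a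

PlusMinus : ℕ → ℕ → ℕ → Set
PlusMinus n e d = d ≡ e ⊎ d ≡ n ∸ e

diffMod-+ˡ : ∀ {n} a e → e < suc n → diffMod (suc n) (a + e) a ≡ e
diffMod-+ˡ {n} a e e<n = begin
  (a + e + suc n ∸ a) % suc n   ≡⟨ cong (λ x → (x ∸ a) % suc n) (+-assoc a e (suc n)) ⟩
  (a + (e + suc n) ∸ a) % suc n ≡⟨ cong (_% suc n) (m+n∸m≡n a (e + suc n)) ⟩
  (e + suc n) % suc n           ≡⟨ [m+n]%n≡m%n e (suc n) ⟩
  e % suc n                     ≡⟨ m<n⇒m%n≡m e<n ⟩
  e                             ∎

diffMod-+ʳ : ∀ {n} a e → 0 < e → diffMod (suc n) a (a + e) ≡ suc n ∸ e
diffMod-+ʳ {n} a (suc e) _ = begin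
  (a + suc n ∸ (a + suc e)) % suc n ≡⟨ cong (_% suc n) ([m+n]∸[m+o]≡n∸o a (suc n) (suc e)) ⟩
  (n ∸ e) % suc n                   ≡⟨ m<n⇒m%n≡m (s≤s (m∸n≤m n e)) ⟩
  n ∸ e                             ∎

ModDiff⇔PlusMinus : ∀ {n e a b d} → 0 < e → e < suc n → Differ e a b →
  ModDiff (suc n) a b d ⇔ PlusMinus (suc n) e d
ModDiff⇔PlusMinus {n} {e} {a} 0<e e<n (inj₁ refl)
  rewrite diffMod-+ʳ {n} a e 0<e | diffMod-+ˡ {n} a e e<n = mk⇔ swap swap
ModDiff⇔PlusMinus {n} {e} {b = b} 0<e e<n (inj₂ refl)
  rewrite diffMod-+ˡ {n} b e e<n | diffMod-+ʳ {n} b e 0<e = mk⇔ id id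

record StepLengths (P : ℕ → Set) (w : ℕ → ℕ) (n : ℕ) : Set where
  field
    length-of : ∀ {j} → j < n → ∃[ e ] P e × Differ e (w j) (w (suc j))
    step-of   : ∀ {e} → P e → ∃[ j ] j < n × Differ e (w j) (w (suc j))

∃ModDiff⇔∃PlusMinus : ∀ {P w m n d} → StepLengths P w m → (∀ {e} → P e → 0 < e × e < suc n) →
  (∃[ j ] j < m × ModDiff (suc n) (w j) (w (suc j)) d) ⇔ (∃[ e ] P e × PlusMinus (suc n) e d)
∃ModDiff⇔∃PlusMinus {P} {w} {m} {n} {d} steps bounded = mk⇔ to from
  where
  open StepLengths steps
  step⇔ : ∀ {e j} → P e → Differ e (w j) (w (suc j)) →
    ModDiff (suc n) (w j) (w (suc j)) d ⇔ PlusMinus (suc n) e d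
  step⇔ Pe δ = let (0<e , e<n) = bounded Pe in ModDiff⇔PlusMinus 0<e e<n δ
  to : ∃[ j ] j < m × ModDiff (suc n) (w j) (w (suc j)) d → ∃[ e ] P e × PlusMinus (suc n) e d
  to (j , j<m , dd) with length-of j<m
  ... | e , Pe , δ = e , Pe , Equivalence.to (step⇔ Pe δ) dd
  from : ∃[ e ] P e × PlusMinus (suc n) e d → ∃[ j ] j < m × ModDiff (suc n) (w j) (w (suc j)) d
  from (e , Pe , sd) with step-of Pe
  ... | j , j<m , δ = j , j<m , Equivalence.from (step⇔ Pe δ) sd

InjectiveOn : ℕ → (ℕ → ℕ) → Set
InjectiveOn n w = ∀ {i j} → i ≤ n → j ≤ n → w i ≡ w j → i ≡ j

toℕ-mod : ∀ {a n} .{{_ : NonZero n}} → a < n → toℕ (a mod n) ≡ a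
toℕ-mod a<n = trans (toℕ-fromℕ< _) (m<n⇒m%n≡m a<n)

module ∞-Cycle {m : ℕ} (w : ℕ → ℕ) (w-< : ∀ {i} → i ≤ m → w i < 2 * suc (suc m))
               (w-injective : InjectiveOn m w) where

  ℓ : ℕ
  ℓ = suc (suc m)

  vertex : ℕ → Vertex ℓ
  vertex zero    = nothing
  vertex (suc i) = just (w i mod (2 * ℓ))

  vertex-injective : ∀ {i j} → i < ℓ → j < ℓ → vertex i ≡ vertex j → i ≡ j
  vertex-injective {zero}  {zero}  _         _         _  = refl
  vertex-injective {suc i} {suc j} (s≤s i<ℓ) (s≤s j<ℓ) eq = cong suc (w-injective i≤m j≤m (begin
    w i                   ≡⟨ toℕ-mod (w-< i≤m) ⟨
    toℕ (w i mod (2 * ℓ)) ≡⟨ cong toℕ (just-injective eq) ⟩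
    toℕ (w j mod (2 * ℓ)) ≡⟨ toℕ-mod (w-< j≤m) ⟩
    w j                   ∎))
    where
    i≤m : i ≤ m
    i≤m = <⇒≤pred i<ℓ
    j≤m : j ≤ m
    j≤m = <⇒≤pred j<ℓ

  cycle : Cycle (Vertex ℓ) ℓ
  cycle = record
    { vert     = λ i → vertex (toℕ i)
    ; distinct = λ {i} {j} eq → toℕ-injective (vertex-injective (toℕ<n i) (toℕ<n j) eq)
    }

  toℕ-next : ∀ {i : Fin ℓ} {j} → toℕ i ≡ j → toℕ (next i) ≡ suc j % ℓ
  toℕ-next refl = toℕ-fromℕ< _

  data EdgeView (i : Fin ℓ) : Set where
    from-∞ : toℕ i ≡ 0 → EdgeView i
    into-∞ : toℕ (next i) ≡ 0 → EdgeView i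
    inner  : ∀ {j} → j < m → toℕ i ≡ suc j → toℕ (next i) ≡ suc (suc j) → EdgeView i

  inner-next : ∀ {i : Fin ℓ} {j} → j < m → toℕ i ≡ suc j → toℕ (next i) ≡ suc (suc j)
  inner-next j<m i≡1+j = trans (toℕ-next i≡1+j) (m<n⇒m%n≡m (s≤s (s≤s j<m)))

  edgeView : ∀ i → EdgeView i
  edgeView i with toℕ i in i≡t | toℕ<n i
  ... | zero  | _         = from-∞ i≡t
  ... | suc j | s≤s j<1+m with m≤n⇒m<n∨m≡n (<⇒≤pred j<1+m)
  ...   | inj₁ j<m  = inner j<m i≡t (inner-next j<m i≡t)
  ...   | inj₂ refl = into-∞ (trans (toℕ-next i≡t) (n%n≡0 ℓ))

  innerEdge : ∀ {j} → j < m → ∃[ i ] toℕ i ≡ suc j × toℕ (next i) ≡ suc (suc j)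
  innerEdge {j} j<m = fromℕ< 1+j<ℓ , toℕ-fromℕ< 1+j<ℓ , inner-next j<m (toℕ-fromℕ< 1+j<ℓ)
    where
    1+j<ℓ : suc j < ℓ
    1+j<ℓ = s≤s (s≤s (<⇒≤ j<m))

  vertex-value : ∀ {i j x} → j ≤ m → toℕ i ≡ suc j → vert cycle i ≡ just x → toℕ x ≡ w j
  vertex-value j≤m i≡1+j vi≡x =
    trans (cong toℕ (just-injective (trans (sym vi≡x) (cong vertex i≡1+j)))) (toℕ-mod (w-< j≤m))

  ∞-not-just : ∀ {t x} → t ≡ 0 → vertex t ≢ just x
  ∞-not-just refl ()

  ∈∂-cycle⇔ : ∀ {d} → d ∈∂ cycle ⇔ (∃[ j ] j < m × ModDiff (2 * ℓ) (w j) (w (suc j)) d)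
  ∈∂-cycle⇔ {d} = mk⇔ to from
    where
    to : d ∈∂ cycle → ∃[ j ] j < m × ModDiff (2 * ℓ) (w j) (w (suc j)) d
    to (i , x , y , vi≡x , vni≡y , dd) with edgeView i
    ... | from-∞ i≡0  = ⊥-elim (∞-not-just i≡0 vi≡x)
    ... | into-∞ ni≡0 = ⊥-elim (∞-not-just ni≡0 vni≡y)
    ... | inner j<m i≡1+j ni≡2+j =
      _ , j<m , subst₂ (λ a b → ModDiff (2 * ℓ) a b d)
                       (vertex-value (<⇒≤ j<m) i≡1+j vi≡x) (vertex-value j<m ni≡2+j vni≡y) dd
    from : ∃[ j ] j < m × ModDiff (2 * ℓ) (w j) (w (suc j)) d → d ∈∂ cycle
    from (j , j<m , dd) with innerEdge j<m
    ... | i , i≡1+j , ni≡2+j =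
      i , _ , _ , cong vertex i≡1+j , cong vertex ni≡2+j ,
      subst₂ (λ a b → ModDiff (2 * ℓ) a b d)
             (sym (toℕ-mod (w-< (<⇒≤ j<m)))) (sym (toℕ-mod (w-< j<m))) dd

zigzag : List ℕ → ℕ → ℕ
zigzag _        zero    = 0
zigzag []       (suc j) = 0
zigzag (d ∷ ds) (suc j) = d ∸ zigzag ds j

zigzag-< : ∀ {c} ds → All (_< c) ds → 0 < c → ∀ j → zigzag ds j < c
zigzag-< _        _          0<c zero    = 0<c
zigzag-< []       _          0<c (suc j) = 0<c
zigzag-< (d ∷ ds) (d<c ∷ _) _   (suc j) = ≤-<-trans (m∸n≤m d (zigzag ds j)) d<c

zigzag-tail-< : ∀ {d ds} → Linked _>_ (d ∷ ds) → 0 < d → ∀ j → zigzag ds j < d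
zigzag-tail-< {d} {ds} decreasing = zigzag-< ds (below-head decreasing)
  where
  below-head : ∀ {x xs} → Linked _>_ (x ∷ xs) → All (_< x) xs
  below-head [-]          = []
  below-head (x>y ∷ y>ys) = Linked⇒All (λ x>y y>z → <-trans y>z x>y) x>y y>ys

zigzag-injective : ∀ {ds} → Linked _>_ ds → All (0 <_) ds → InjectiveOn (length ds) (zigzag ds)
zigzag-injective {[]} _ _ z≤n z≤n _ = refl
zigzag-injective {d ∷ ds} decreasing (0<d ∷ positive) = injective
  where
  below : ∀ j → zigzag ds j < d
  below = zigzag-tail-< decreasing 0<d
  injective : InjectiveOn (suc (length ds)) (zigzag (d ∷ ds))
  injective {zero}  {zero}  _         _         _  = refl
  injective {zero}  {suc j} _         _         eq = ⊥-elim (<-irrefl eq (m<n⇒0<n∸m (below j)))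
  injective {suc i} {zero}  _         _         eq = ⊥-elim (<-irrefl (sym eq) (m<n⇒0<n∸m (below i)))
  injective {suc i} {suc j} (s≤s i≤n) (s≤s j≤n) eq =
    cong suc (zigzag-injective (Linked.tail decreasing) positive i≤n j≤n
      (∸-cancelˡ-≡ (<⇒≤ (below i)) (<⇒≤ (below j)) eq))

zigzag-steps : ∀ {ds} → Linked _>_ ds → All (0 <_) ds → StepLengths (_∈ ds) (zigzag ds) (length ds)
zigzag-steps {[]}     _          _                  = record { length-of = λ () ; step-of = λ () }
zigzag-steps {d ∷ ds} decreasing (0<d ∷ positive) = record { length-of = length-of′ ; step-of = step-of′ }
  where
  open StepLengths (zigzag-steps (Linked.tail decreasing) positive)
  below : ∀ j → zigzag ds j ≤ d
  below j = <⇒≤ (zigzag-tail-< decreasing 0<d j)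
  reflected : ∀ {e j} → Differ e (zigzag ds j) (zigzag ds (suc j)) →
    Differ e (zigzag (d ∷ ds) (suc j)) (zigzag (d ∷ ds) (suc (suc j)))
  reflected {j = j} = Differ-reflect d (below j) (below (suc j))
  length-of′ : ∀ {j} → j < suc (length ds) →
    ∃[ e ] e ∈ d ∷ ds × Differ e (zigzag (d ∷ ds) j) (zigzag (d ∷ ds) (suc j))
  length-of′ {zero}  _         = d , here refl , inj₁ refl
  length-of′ {suc j} (s≤s j<n) with length-of j<n
  ... | e , e∈ds , δ = e , there e∈ds , reflected δ
  step-of′ : ∀ {e} → e ∈ d ∷ ds →
    ∃[ j ] j < suc (length ds) × Differ e (zigzag (d ∷ ds) j) (zigzag (d ∷ ds) (suc j))
  step-of′ (here refl) = 0 , s≤s z≤n , inj₁ refl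
  step-of′ (there e∈ds) with step-of e∈ds
  ... | j , j<n , δ = suc j , s≤s j<n , reflected δ

module Mirror (k ℓ : ℕ) (f : ℕ → ℕ) where

  S : ℕ
  S = suc (k + k)

  mirror : ℕ → ℕ
  mirror n with n ≤? k
  ... | yes _ = f n
  ... | no  _ = f (S ∸ n) + ℓ

  mirror-≤ : ∀ {n} → n ≤ k → mirror n ≡ f n
  mirror-≤ {n} n≤k with n ≤? k
  ... | yes _   = refl
  ... | no  n≰k = ⊥-elim (n≰k n≤k)

  mirror-> : ∀ {n} → k < n → mirror n ≡ f (S ∸ n) + ℓ
  mirror-> {n} k<n with n ≤? k
  ... | yes n≤k = ⊥-elim (<⇒≱ k<n n≤k)
  ... | no  _   = refl

  S∸n≤k : ∀ {n} → k < n → S ∸ n ≤ k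
  S∸n≤k k<n = ≤-trans (∸-monoʳ-≤ S k<n) (≤-reflexive (m+n∸m≡n k k))

  module _ (f-< : ∀ {i} → i ≤ k → f i < ℓ) where

    mirror-< : ∀ n → mirror n < 2 * ℓ
    mirror-< n with ≤-<-connex n k
    ... | inj₁ n≤k rewrite mirror-≤ n≤k = <-≤-trans (f-< n≤k) (m≤m+n ℓ (ℓ + 0))
    ... | inj₂ k<n rewrite mirror-> k<n = <-≤-trans (+-monoˡ-< ℓ (f-< (S∸n≤k k<n)))
                                                    (≤-reflexive (cong (ℓ +_) (sym (+-identityʳ ℓ))))

    first≢second : ∀ {i n} → i ≤ k → k < n → mirror i ≢ mirror n
    first≢second i≤k k<n eq = <⇒≢ (<-≤-trans (f-< i≤k) (m≤n+m ℓ _))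
                                  (trans (sym (mirror-≤ i≤k)) (trans eq (mirror-> k<n)))

    mirror-injective : InjectiveOn k f → InjectiveOn S mirror
    mirror-injective f-injective {i} {j} i≤S j≤S eq with ≤-<-connex i k | ≤-<-connex j k
    ... | inj₁ i≤k | inj₁ j≤k = f-injective i≤k j≤k (begin
      f i      ≡⟨ mirror-≤ i≤k ⟨
      mirror i ≡⟨ eq ⟩
      mirror j ≡⟨ mirror-≤ j≤k ⟩
      f j      ∎)
    ... | inj₁ i≤k | inj₂ k<j = ⊥-elim (first≢second i≤k k<j eq)
    ... | inj₂ k<i | inj₁ j≤k = ⊥-elim (first≢second j≤k k<i (sym eq))
    ... | inj₂ k<i | inj₂ k<j = ∸-cancelˡ-≡ i≤S j≤S
      (f-injective (S∸n≤k k<i) (S∸n≤k k<j) (+-cancelʳ-≡ ℓ _ _ (begin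
        f (S ∸ i) + ℓ ≡⟨ mirror-> k<i ⟨
        mirror i      ≡⟨ eq ⟩
        mirror j      ≡⟨ mirror-> k<j ⟩
        f (S ∸ j) + ℓ ∎)))

  module _ {P : ℕ → Set} (f-steps : StepLengths P f k) where
    open StepLengths f-steps

    S∸[1+k]≡k : S ∸ suc k ≡ k
    S∸[1+k]≡k = m+n∸m≡n k k

    first-half-step : ∀ {e j} → j < k → Differ e (f j) (f (suc j)) → Differ e (mirror j) (mirror (suc j))
    first-half-step j<k = subst₂ (Differ _) (sym (mirror-≤ (<⇒≤ j<k))) (sym (mirror-≤ j<k))

    centre-step : Differ ℓ (mirror k) (mirror (suc k))
    centre-step = inj₁ (begin
      mirror (suc k)    ≡⟨ mirror-> ≤-refl ⟩
      f (S ∸ suc k) + ℓ ≡⟨ cong (λ i → f i + ℓ) S∸[1+k]≡k ⟩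
      f k + ℓ           ≡⟨ cong (_+ ℓ) (mirror-≤ ≤-refl) ⟨
      mirror k + ℓ      ∎)

    second-half-step : ∀ {j} → k < j → j < S → ∃[ e ] P e × Differ e (mirror j) (mirror (suc j))
    second-half-step {j} k<j j<S = reflected (length-of i<k)
      where
      i : ℕ
      i = S ∸ suc j
      S∸j≡1+i : S ∸ j ≡ suc i
      S∸j≡1+i = +-∸-assoc 1 j<S
      i<k : i < k
      i<k = subst (_≤ k) S∸j≡1+i (S∸n≤k k<j)
      mirror-j : mirror j ≡ f (suc i) + ℓ
      mirror-j = trans (mirror-> k<j) (cong (λ x → f x + ℓ) S∸j≡1+i)
      reflected : ∃[ e ] P e × Differ e (f i) (f (suc i)) → ∃[ e ] P e × Differ e (mirror j) (mirror (suc j))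
      reflected (e , Pe , δ) =
        e , Pe , subst₂ (Differ e) (sym mirror-j) (sym (mirror-> (m<n⇒m<1+n k<j))) (Differ-+ʳ ℓ (swap δ))

    mirror-steps : StepLengths (λ e → e ≡ ℓ ⊎ P e) mirror S
    mirror-steps = record { length-of = mirror-length-of ; step-of = mirror-step-of }
      where
      mirror-length-of : ∀ {j} → j < S → ∃[ e ] (e ≡ ℓ ⊎ P e) × Differ e (mirror j) (mirror (suc j))
      mirror-length-of {j} j<S with <-cmp j k
      ... | tri< j<k _ _ with length-of j<k
      ...   | e , Pe , δ = e , inj₂ Pe , first-half-step j<k δ
      mirror-length-of j<S | tri≈ _ refl _ = ℓ , inj₁ refl , centre-step
      mirror-length-of j<S | tri> _ _ k<j with second-half-step k<j j<S
      ...   | e , Pe , δ = e , inj₂ Pe , δ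
      mirror-step-of : ∀ {e} → e ≡ ℓ ⊎ P e → ∃[ j ] j < S × Differ e (mirror j) (mirror (suc j))
      mirror-step-of (inj₁ refl) = k , s≤s (m≤m+n k k) , centre-step
      mirror-step-of (inj₂ Pe) with step-of Pe
      ... | j , j<k , δ = j , ≤-trans j<k (≤-trans (m≤m+n k k) (n≤1+n _)) , first-half-step j<k δ

InPmDℓ⇔ : ∀ {ℓ D d} → InPmDℓ ℓ D d ⇔ (∃[ e ] (e ≡ ℓ ⊎ e ∈ D) × PlusMinus (2 * ℓ) e d)
InPmDℓ⇔ {ℓ} {D} {d} = mk⇔ to from
  where
  to : InPmDℓ ℓ D d → ∃[ e ] (e ≡ ℓ ⊎ e ∈ D) × PlusMinus (2 * ℓ) e d
  to (inj₁ refl)             = ℓ , inj₁ refl , inj₁ refl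
  to (inj₂ (e , e∈D , d≡±e)) = e , inj₂ e∈D , d≡±e
  from : ∃[ e ] (e ≡ ℓ ⊎ e ∈ D) × PlusMinus (2 * ℓ) e d → InPmDℓ ℓ D d
  from (e , inj₁ refl , inj₁ d≡ℓ)  = inj₁ d≡ℓ
  from (e , inj₁ refl , inj₂ d≡-ℓ) = inj₁ (trans d≡-ℓ (trans (m+n∸m≡n ℓ (ℓ + 0)) (+-identityʳ ℓ)))
  from (e , inj₂ e∈D , d≡±e)      = inj₂ (e , e∈D , d≡±e)

module OddCycle {D : List ℕ} (decreasing : Linked _>_ D)
                (bounded : All (λ d → 1 ≤ d × d ≤ suc (suc (length D + length D))) D) where

  k ℓ : ℕ
  k = length D
  ℓ = suc (suc (suc (k + k)))

  open Mirror k ℓ (zigzag D)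

  positive : All (0 <_) D
  positive = All.map proj₁ bounded

  zigzag-<ℓ : ∀ {i} → i ≤ k → zigzag D i < ℓ
  zigzag-<ℓ {i} _ = zigzag-< D (All.map (s≤s ∘ proj₂) bounded) (s≤s z≤n) i

  label-bounds : ∀ {e} → e ≡ ℓ ⊎ e ∈ D → 0 < e × e < 2 * ℓ
  label-bounds (inj₁ refl) = s≤s z≤n , m<m+n ℓ (s≤s z≤n)
  label-bounds (inj₂ e∈D)  = proj₁ (All.lookup bounded e∈D) ,
                             <-≤-trans (s≤s (proj₂ (All.lookup bounded e∈D))) (m≤m+n ℓ (ℓ + 0))

  open ∞-Cycle mirror (λ {i} _ → mirror-< zigzag-<ℓ i)
                      (mirror-injective zigzag-<ℓ (zigzag-injective decreasing positive))
    using (cycle; ∈∂-cycle⇔)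

  odd-cycle : Σ (Cycle (Vertex ℓ) ℓ) λ C → ∀ d → d ∈∂ C ⇔ InPmDℓ ℓ D d
  odd-cycle = cycle , λ d →
    ⇔-sym InPmDℓ⇔ ⇔-∘ (∃ModDiff⇔∃PlusMinus walk-steps label-bounds ⇔-∘ ∈∂-cycle⇔)
    where
    walk-steps : StepLengths (λ e → e ≡ ℓ ⊎ e ∈ D) mirror S
    walk-steps = mirror-steps (zigzag-steps decreasing positive)

m≡m/2+m/2 : ∀ m → suc m % 2 ≡ 1 → m ≡ m / 2 + m / 2
m≡m/2+m/2 zero          _   = refl
m≡m/2+m/2 (suc (suc m)) odd = begin
  suc (suc m)                       ≡⟨ cong (suc ∘ suc) (m≡m/2+m/2 m odd) ⟩
  suc (suc (m / 2 + m / 2))         ≡⟨ cong suc (+-suc (m / 2) (m / 2)) ⟨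
  suc (m / 2) + suc (m / 2)         ≡⟨ cong₂ _+_ [2+m]/2≡1+m/2 [2+m]/2≡1+m/2 ⟨
  suc (suc m) / 2 + suc (suc m) / 2 ∎
  where
  [2+m]/2≡1+m/2 : suc (suc m) / 2 ≡ suc (m / 2)
  [2+m]/2≡1+m/2 = m/n≡1+[m∸n]/n {suc (suc m)} (s≤s (s≤s z≤n))

lemma5 : (ℓ : ℕ) → 3 ≤ ℓ → ℓ % 2 ≡ 1 →
    (D : List ℕ) → Linked _>_ D → length D ≡ (ℓ ∸ 3) / 2 →
    All (λ d → 1 ≤ d × d ≤ ℓ ∸ 1) D →
    Σ (Cycle (Vertex ℓ) ℓ) λ C → (d : ℕ) → (d ∈∂ C) ⇔ InPmDℓ ℓ D d
lemma5 (suc (suc (suc m))) (s≤s (s≤s (s≤s _))) odd D decreasing length-D =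
  cycle-of-size m (trans (m≡m/2+m/2 m odd) (cong (λ k → k + k) (sym length-D)))
  where
  cycle-of-size : ∀ n → n ≡ length D + length D → All (λ d → 1 ≤ d × d ≤ suc (suc n)) D →
    Σ (Cycle (Vertex (3 + n)) (3 + n)) λ C → ∀ d → d ∈∂ C ⇔ InPmDℓ (3 + n) D d
  cycle-of-size _ refl = OddCycle.odd-cycle decreasing
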